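{- For $n\ge3$, let $Q_1^{\mathrm{int}}(n)$ be the total, over all $\pi\in\mathrm{Av}_n(213)$, of the number of degree-$1$ vertices of the grid graph $G_\pi$ lying in internal columns (i.e. vertices $(i,s)$ with $2\le i\le n-1$). Then $Q_1^{\mathrm{int}}(n)=(n-2)\,C_{n-1}$, where $C_k=\frac{1}{k+1}\binom{2k}{k}$.
   Context: The grid graph $G_\pi$ of a permutation $\pi=\pi_1\cdots\pi_n$ of $[n]$ has vertex set $\{(i,j):1\le i\le n,\ 1\le j\le \pi_i\}$; two vertices $(i,j),(i',j')$ are adjacent iff either $i=i'$ and $|j-j'|=1$, or $|i-i'|=1$ and $j=j'$. $\mathrm{Av}_n(213)$ is the set of permutations of $[n]$ with no $p<q<r$ such that $\pi_q<\pi_p<\pi_r$. -}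

module Defs where

open import Data.Nat using (ℕ; zero; suc; _+_; _*_; _∸_; _≤_; _<_; _≤ᵇ_; _≡ᵇ_; _/_)
open import Data.Nat.Combinatorics using (_C_)
open import Data.List using (List; []; _∷_; length; map; upTo)
open import Data.Nat.ListAction using (sum)
open import Data.List.Relation.Binary.Permutation.Propositional using (_↭_)
open import Data.Bool using (Bool; true; false; if_then_else_; _∧_)
open import Data.Product using (_×_)
open import Relation.Nullary using (¬_)

-- 1-indexed entry of a list; 0 outside positions 1..length
at : List ℕ → ℕ → ℕ
at []       _             = 0
at (x ∷ xs) zero          = 0
at (x ∷ xs) (suc zero)    = x
at (x ∷ xs) (suc (suc i)) = at xs (suc i)

range : ℕ → ℕ → List ℕ
range a k = map (a +_) (upTo k)

IsPerm : ℕ → List ℕ → Set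
IsPerm n π = π ↭ range 1 n

Avoids213 : List ℕ → Set
Avoids213 π = ∀ p q r → 1 ≤ p → p < q → q < r → r ≤ length π →
  ¬ (at π q < at π p × at π p < at π r)

isVertex : List ℕ → ℕ → ℕ → Bool
isVertex π i j = (1 ≤ᵇ i) ∧ (i ≤ᵇ length π) ∧ (1 ≤ᵇ j) ∧ (j ≤ᵇ at π i)

b2n : Bool → ℕ
b2n true  = 1
b2n false = 0

-- degree of (i,j) in G_π, for a vertex with i ≥ 1 and j ≥ 1
-- neighbours: (i, j-1), (i, j+1), (i-1, j), (i+1, j)
degree : List ℕ → ℕ → ℕ → ℕ
degree π i j =
    b2n (isVertex π i (j ∸ 1))
  + b2n (isVertex π i (suc j))
  + b2n (isVertex π (i ∸ 1) j)
  + b2n (isVertex π (suc i) j)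

deg1Internal : List ℕ → ℕ
deg1Internal π =
  sum (map (λ i → sum (map (λ j → b2n (degree π i j ≡ᵇ 1)) (range 1 (at π i))))
           (range 2 (length π ∸ 2)))

catalan : ℕ → ℕ
catalan k = ((2 * k) C k) / suc k

-- A cell of an internal column has degree one exactly when it is the top cell and both neighbouring
-- columns are lower, so Q₁ⁱⁿᵗ(n) counts the pairs (π, i) where π has a peak at an internal position i.
-- A 213-avoider of size m + 1 with first entry x consists of x, then a 213-avoider on the values above x,
-- then one on the values below x; L is a permutation of the enumeration of Av_n(213) built this way.
-- Following a position through the decomposition shows, by induction, that every position 1 ≤ i ≤ n is a
-- peak of exactly C(n−1) avoiders: peaks among the g larger values contribute C(g−1)·C(m−g), peaks among
-- the smaller values C(g)·C(m−g−1), and after a shift by one these sums recombine into the Segner recursion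
-- for C(m). Summing over the n − 2 internal positions gives (n − 2)·C(n−1). The Segner recursion for
-- binom(2k, k)/(k + 1) itself comes from the ballot numbers [xⁿ] c(x)ᵏ.
{-# OPTIONS --safe #-}
module Submission where

open import Defs
open import Data.Bool.Base using (Bool; true; false; _∧_)
open import Data.Bool.Properties using (T-≡; ¬-not)
open import Data.List.Base
  using (List; []; _∷_; _++_; length; null; map; concat; concatMap; filter; applyUpTo; upTo; cartesianProductWith)
open import Data.List.Properties
  using (map-++; map-∘; map-cong; map-cong-local; map-id-local; map-upTo; upTo-∷ʳ; length-map; length-upTo;
         ++-identityʳ; ++-cancelˡ; ∷-injectiveˡ; ∷-injectiveʳ; filter-++; filter-all; filter-none; filter-reject)
open import Data.List.Membership.Propositional using (_∈_; find; lose)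
open import Data.List.Membership.Propositional.Properties
  using (∈-map⁻; ∈-upTo⁺; ∈-upTo⁻; ∈-concatMap⁺; ∈-concatMap⁻; ∈-cartesianProductWith⁺; ∈-cartesianProductWith⁻)
open import Data.List.Membership.Propositional.Properties.WithK using (unique∧set⇒bag)
open import Data.List.Relation.Binary.BagAndSetEquality using (∼bag⇒↭)
open import Data.List.Relation.Binary.Disjoint.Propositional using (Disjoint)
open import Data.List.Relation.Binary.Permutation.Propositional
  using (_↭_; ↭-refl; ↭-sym; ↭-trans; ↭-prep; ↭-reflexive; ↭⇒↭ₛ)
open import Data.List.Relation.Binary.Permutation.Propositional.Properties
  using (All-resp-↭; ↭-empty-inv; ↭-length; ++-comm; ++⁺; map⁺; shift; filter-↭)
open import Data.List.Relation.Unary.All as All using (All; []; _∷_)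
import Data.List.Relation.Unary.All.Properties as All
open import Data.List.Relation.Unary.AllPairs as AllPairs using (AllPairs; []; _∷_)
import Data.List.Relation.Unary.AllPairs.Properties as AllPairs
open import Data.List.Relation.Unary.Any using (here; there)
open import Data.List.Relation.Unary.Unique.Propositional using (Unique)
import Data.List.Relation.Unary.Unique.Propositional.Properties as Unique
open import Data.Nat.Base
open import Data.Nat.Combinatorics
  using (_C_; nCk≡nC[n∸k]; nC1≡n; k>n⇒nCk≡0) renaming (nCk+nC[k+1]≡[n+1]C[k+1] to pascal)
open import Data.Nat.DivMod using (m*n/n≡m)
open import Data.Nat.ListAction using (sum)
open import Data.Nat.ListAction.Properties using (sum-++; sum-↭)
open import Data.Nat.Properties
open import Data.Nat.Solver using (module +-*-Solver)
open import Algebra.Properties.CommutativeSemigroup +-commutativeSemigroup using () renaming (interchange to +-interchange)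
open import Data.Product.Base using (_×_; _,_; proj₁; proj₂; ∃; ∃₂)
open import Data.Sum.Base using (inj₁; inj₂)
open import Data.Unit.Base using (⊤; tt)
open import Function.Base using (_∘_)
open import Function.Bundles using (_⇔_; mk⇔; Equivalence)
open import Relation.Binary.Definitions using (tri<; tri≈; tri>)
open import Relation.Binary.PropositionalEquality
open import Relation.Nullary.Negation using (¬_; contradiction)

open import Data.List.Relation.Binary.Permutation.Setoid.Properties (setoid ℕ) using (Unique-resp-↭)
open ≡-Reasoning
open +-*-Solver

private variable
  A B D : Set

sum-map-cong : {f g : A → ℕ} (xs : List A) → (∀ {x} → x ∈ xs → f x ≡ g x) →
               sum (map f xs) ≡ sum (map g xs)
sum-map-cong xs f≡g = cong sum (map-cong-local (All.tabulate f≡g))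

sum-map-+ : (f g : A → ℕ) (xs : List A) →
            sum (map (λ x → f x + g x) xs) ≡ sum (map f xs) + sum (map g xs)
sum-map-+ f g []       = refl
sum-map-+ f g (x ∷ xs) = begin
  f x + g x + sum (map (λ x → f x + g x) xs)         ≡⟨ cong (f x + g x +_) (sum-map-+ f g xs) ⟩
  f x + g x + (sum (map f xs) + sum (map g xs))      ≡⟨ +-interchange (f x) (g x) (sum (map f xs)) (sum (map g xs)) ⟩
  f x + sum (map f xs) + (g x + sum (map g xs))      ∎

sum-map-*ˡ : (c : ℕ) (f : A → ℕ) (xs : List A) →
             sum (map (λ x → c * f x) xs) ≡ c * sum (map f xs)
sum-map-*ˡ c f []       = sym (*-zeroʳ c)
sum-map-*ˡ c f (x ∷ xs) = trans (cong (c * f x +_) (sum-map-*ˡ c f xs)) (sym (*-distribˡ-+ c (f x) _))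

sum-map-const : (c : ℕ) (xs : List A) → sum (map (λ _ → c) xs) ≡ length xs * c
sum-map-const c []       = refl
sum-map-const c (x ∷ xs) = cong (c +_) (sum-map-const c xs)

sum-map-swap : (F : A → B → ℕ) (xs : List A) (ys : List B) →
               sum (map (λ x → sum (map (F x) ys)) xs) ≡ sum (map (λ y → sum (map (λ x → F x y) xs)) ys)
sum-map-swap F []       ys = sym (trans (sum-map-const 0 ys) (*-zeroʳ (length ys)))
sum-map-swap F (x ∷ xs) ys = begin
  sum (map (F x) ys) + sum (map (λ x → sum (map (F x) ys)) xs)      ≡⟨ cong (sum (map (F x) ys) +_) (sum-map-swap F xs ys) ⟩
  sum (map (F x) ys) + sum (map (λ y → sum (map (λ x → F x y) xs)) ys)  ≡⟨ sym (sum-map-+ (F x) _ ys) ⟩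
  sum (map (λ y → F x y + sum (map (λ x → F x y) xs)) ys)           ∎

sum-map-concat : (f : A → ℕ) (xss : List (List A)) →
                 sum (map f (concat xss)) ≡ sum (map (sum ∘ map f) xss)
sum-map-concat f []         = refl
sum-map-concat f (xs ∷ xss) = begin
  sum (map f (xs ++ concat xss))              ≡⟨ cong sum (map-++ f xs (concat xss)) ⟩
  sum (map f xs ++ map f (concat xss))        ≡⟨ sum-++ (map f xs) _ ⟩
  sum (map f xs) + sum (map f (concat xss))   ≡⟨ cong (sum (map f xs) +_) (sum-map-concat f xss) ⟩
  sum (map f xs) + sum (map (sum ∘ map f) xss) ∎

sum-map-cartesianProductWith : (f : D → ℕ) (h : A → B → D) (xs : List A) (ys : List B) →
  sum (map f (cartesianProductWith h xs ys)) ≡ sum (map (λ x → sum (map (λ y → f (h x y)) ys)) xs)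
sum-map-cartesianProductWith f h []       ys = refl
sum-map-cartesianProductWith f h (x ∷ xs) ys = begin
  sum (map f (map (h x) ys ++ cartesianProductWith h xs ys))
    ≡⟨ cong sum (map-++ f (map (h x) ys) _) ⟩
  sum (map f (map (h x) ys) ++ map f (cartesianProductWith h xs ys))
    ≡⟨ sum-++ (map f (map (h x) ys)) _ ⟩
  sum (map f (map (h x) ys)) + sum (map f (cartesianProductWith h xs ys))
    ≡⟨ cong₂ _+_ (cong sum (sym (map-∘ ys))) (sum-map-cartesianProductWith f h xs ys) ⟩
  sum (map (λ y → f (h x y)) ys) + sum (map (λ x → sum (map (λ y → f (h x y)) ys)) xs) ∎

sum-map-zero : {f : A → ℕ} (xs : List A) → (∀ {x} → x ∈ xs → f x ≡ 0) → sum (map f xs) ≡ 0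
sum-map-zero xs f≡0 = trans (sum-map-cong xs f≡0) (trans (sum-map-const 0 xs) (*-zeroʳ (length xs)))

sum-map-cartesianProductWithˡ : (f : D → ℕ) (h : A → B → D) (g : A → ℕ) (xs : List A) (ys : List B) →
  (∀ {x y} → x ∈ xs → y ∈ ys → f (h x y) ≡ g x) →
  sum (map f (cartesianProductWith h xs ys)) ≡ length ys * sum (map g xs)
sum-map-cartesianProductWithˡ f h g xs ys f∘h≡g = begin
  sum (map f (cartesianProductWith h xs ys))               ≡⟨ sum-map-cartesianProductWith f h xs ys ⟩
  sum (map (λ x → sum (map (λ y → f (h x y)) ys)) xs)
    ≡⟨ sum-map-cong xs (λ {x} x∈ → trans (sum-map-cong ys (f∘h≡g x∈)) (sum-map-const (g x) ys)) ⟩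
  sum (map (λ x → length ys * g x) xs)                     ≡⟨ sum-map-*ˡ (length ys) g xs ⟩
  length ys * sum (map g xs)                               ∎

sum-map-cartesianProductWithʳ : (f : D → ℕ) (h : A → B → D) (g : B → ℕ) (xs : List A) (ys : List B) →
  (∀ {x y} → x ∈ xs → y ∈ ys → f (h x y) ≡ g y) →
  sum (map f (cartesianProductWith h xs ys)) ≡ length xs * sum (map g ys)
sum-map-cartesianProductWithʳ f h g xs ys f∘h≡g = begin
  sum (map f (cartesianProductWith h xs ys))               ≡⟨ sum-map-cartesianProductWith f h xs ys ⟩
  sum (map (λ x → sum (map (λ y → f (h x y)) ys)) xs)      ≡⟨ sum-map-cong xs (λ x∈ → sum-map-cong ys (f∘h≡g x∈)) ⟩
  sum (map (λ _ → sum (map g ys)) xs)                      ≡⟨ sum-map-const (sum (map g ys)) xs ⟩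
  length xs * sum (map g ys)                               ∎

∑< : ℕ → (ℕ → ℕ) → ℕ
∑< n f = sum (map f (upTo n))

infixl 10 ∑<

syntax ∑< n (λ i → e) = ∑[ i < n ] e

∑<-suc : ∀ n (f : ℕ → ℕ) → ∑< (suc n) f ≡ ∑< n f + f n
∑<-suc n f = begin
  sum (map f (upTo (suc n)))             ≡⟨ cong (sum ∘ map f) (sym (upTo-∷ʳ n)) ⟩
  sum (map f (upTo n ++ n ∷ []))         ≡⟨ cong sum (map-++ f (upTo n) (n ∷ [])) ⟩
  sum (map f (upTo n) ++ f n ∷ [])       ≡⟨ sum-++ (map f (upTo n)) (f n ∷ []) ⟩
  sum (map f (upTo n)) + (f n + 0)       ≡⟨ cong (∑< n f +_) (+-identityʳ (f n)) ⟩
  ∑< n f + f n                           ∎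

∑<-head : ∀ n (f : ℕ → ℕ) → ∑< (suc n) f ≡ f 0 + ∑< n (f ∘ suc)
∑<-head n f = cong (λ xs → f 0 + sum xs) (trans (cong (map f) (sym (map-upTo suc n))) (sym (map-∘ (upTo n))))

∑<-cong : ∀ n {f g : ℕ → ℕ} → (∀ {i} → i < n → f i ≡ g i) → ∑< n f ≡ ∑< n g
∑<-cong n f≡g = sum-map-cong (upTo n) (f≡g ∘ ∈-upTo⁻)

∑<-zero : ∀ n {f : ℕ → ℕ} → (∀ {i} → i < n → f i ≡ 0) → ∑< n f ≡ 0
∑<-zero n f≡0 = sum-map-zero (upTo n) (f≡0 ∘ ∈-upTo⁻)

-- Catalan numbers

-- ballot n k = [xⁿ] c(x)ᵏ for the Catalan series c = 1 + x c²; the recursion is c^(k+1) = c^k + x c^(k+2).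
ballot : ℕ → ℕ → ℕ
ballot zero    k       = 1
ballot (suc n) zero    = 0
ballot (suc n) (suc k) = ballot (suc n) k + ballot n (suc (suc k))

ballot-∸-suc : ∀ {j n} k → j ≤ n →
  ballot (suc n ∸ j) (suc k) ≡ ballot (suc n ∸ j) k + ballot (n ∸ j) (suc (suc k))
ballot-∸-suc k j≤n rewrite +-∸-assoc 1 j≤n = refl

ballot-convolution : ∀ n k → ∑[ j < suc n ] (ballot j 1 * ballot (n ∸ j) k) ≡ ballot n (suc k)
ballot-convolution zero    k       = refl
ballot-convolution (suc n) zero    = begin
  ∑[ j < suc (suc n) ] (ballot j 1 * ballot (suc n ∸ j) 0)
    ≡⟨ ∑<-suc (suc n) (λ j → ballot j 1 * ballot (suc n ∸ j) 0) ⟩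
  ∑[ j < suc n ] (ballot j 1 * ballot (suc n ∸ j) 0) + ballot (suc n) 1 * ballot (n ∸ n) 0
    ≡⟨ cong₂ _+_ (∑<-zero (suc n) vanishes) (cong (λ z → ballot (suc n) 1 * ballot z 0) (n∸n≡0 n)) ⟩
  ballot (suc n) 1 * 1
    ≡⟨ *-identityʳ _ ⟩
  ballot (suc n) 1 ∎
  where
  vanishes : ∀ {j} → j < suc n → ballot j 1 * ballot (suc n ∸ j) 0 ≡ 0
  vanishes {j} j<1+n rewrite +-∸-assoc 1 (≤-pred j<1+n) = *-zeroʳ (ballot j 1)
ballot-convolution (suc n) (suc k) = begin
  ∑[ j < suc (suc n) ] P j (suc k)
    ≡⟨ ∑<-suc (suc n) (λ j → P j (suc k)) ⟩
  ∑[ j < suc n ] P j (suc k) + ballot (suc n) 1 * ballot (n ∸ n) (suc k)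
    ≡⟨ cong₂ _+_ (∑<-cong (suc n) split) (cong (λ z → ballot (suc n) 1 * ballot z (suc k)) (n∸n≡0 n)) ⟩
  ∑[ j < suc n ] (P j k + Q j) + ballot (suc n) 1 * 1
    ≡⟨ cong (_+ ballot (suc n) 1 * 1) (sum-map-+ (λ j → P j k) Q (upTo (suc n))) ⟩
  ∑[ j < suc n ] P j k + ∑[ j < suc n ] Q j + ballot (suc n) 1 * 1
    ≡⟨ solve 3 (λ a b c → a :+ b :+ c := a :+ c :+ b) refl (∑[ j < suc n ] P j k) (∑[ j < suc n ] Q j) _ ⟩
  ∑[ j < suc n ] P j k + ballot (suc n) 1 * 1 + ∑[ j < suc n ] Q j
    ≡⟨ cong (λ z → ∑[ j < suc n ] P j k + ballot (suc n) 1 * ballot z k + ∑[ j < suc n ] Q j) (sym (n∸n≡0 n)) ⟩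
  ∑[ j < suc n ] P j k + P (suc n) k + ∑[ j < suc n ] Q j
    ≡⟨ cong (_+ ∑[ j < suc n ] Q j) (sym (∑<-suc (suc n) (λ j → P j k))) ⟩
  ∑[ j < suc (suc n) ] P j k + ∑[ j < suc n ] Q j
    ≡⟨ cong₂ _+_ (ballot-convolution (suc n) k) (ballot-convolution n (suc (suc k))) ⟩
  ballot (suc n) (suc (suc k)) ∎
  where
  P : ℕ → ℕ → ℕ
  P j k = ballot j 1 * ballot (suc n ∸ j) k
  Q : ℕ → ℕ
  Q j = ballot j 1 * ballot (n ∸ j) (suc (suc k))
  split : ∀ {j} → j < suc n → P j (suc k) ≡ P j k + Q j
  split {j} j<1+n = trans (cong (ballot j 1 *_) (ballot-∸-suc k (≤-pred j<1+n)))
                          (*-distribˡ-+ (ballot j 1) _ _)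

ballot-one : ∀ k → ballot 1 k ≡ k
ballot-one zero    = refl
ballot-one (suc k) = trans (cong (_+ 1) (ballot-one k)) (+-comm k 1)

C-sym : ∀ {N} a b → N ≡ a + b → N C a ≡ N C b
C-sym a b refl = trans (nCk≡nC[n∸k] (m≤m+n a b)) (cong ((a + b) C_) (m+n∸m≡n a b))

ballot-binomial : ∀ n k N → N ≡ 2 * n + k + 2 → ballot (suc n) (suc k) + N C n ≡ N C suc n
ballot-binomial zero    k       N eq = begin
  ballot 1 (suc k) + 1  ≡⟨ cong (_+ 1) (ballot-one (suc k)) ⟩
  suc k + 1             ≡⟨ trans (solve 1 (λ k → (con 1 :+ k) :+ con 1 := k :+ con 2) refl k) (sym eq) ⟩
  N                     ≡⟨ sym (nC1≡n N) ⟩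
  N C 1                 ∎
ballot-binomial (suc n) zero    (suc N) eq = begin
  ballot (suc n) 2 + suc N C suc n            ≡⟨ cong (ballot (suc n) 2 +_) (sym (pascal N n)) ⟩
  ballot (suc n) 2 + (N C n + N C suc n)      ≡⟨ sym (+-assoc (ballot (suc n) 2) _ _) ⟩
  ballot (suc n) 2 + N C n + N C suc n        ≡⟨ cong (_+ N C suc n) (ballot-binomial n 1 N N≡) ⟩
  N C suc n + N C suc n                       ≡⟨ cong (N C suc n +_) (C-sym (suc n) (suc (suc n)) N≡') ⟩
  N C suc n + N C suc (suc n)                 ≡⟨ pascal N (suc n) ⟩
  suc N C suc (suc n)                         ∎
  where
  N≡ : N ≡ 2 * n + 1 + 2
  N≡ = suc-injective (trans eq
         (solve 1 (λ n → con 2 :* (con 1 :+ n) :+ con 0 :+ con 2 := con 1 :+ (con 2 :* n :+ con 1 :+ con 2)) refl n))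
  N≡' : N ≡ suc n + suc (suc n)
  N≡' = trans N≡ (solve 1 (λ n → con 2 :* n :+ con 1 :+ con 2 := (con 1 :+ n) :+ (con 2 :+ n)) refl n)
ballot-binomial (suc n) (suc k) (suc N) eq = begin
  B₁ + B₂ + suc N C suc n                     ≡⟨ cong (B₁ + B₂ +_) (sym (pascal N n)) ⟩
  B₁ + B₂ + (N C n + N C suc n)
    ≡⟨ solve 4 (λ a b c d → a :+ b :+ (c :+ d) := (b :+ c) :+ (a :+ d)) refl B₁ B₂ (N C n) (N C suc n) ⟩
  (B₂ + N C n) + (B₁ + N C suc n)
    ≡⟨ cong₂ _+_ (ballot-binomial n (suc (suc k)) N N≡₂) (ballot-binomial (suc n) k N N≡₁) ⟩
  N C suc n + N C suc (suc n)                 ≡⟨ pascal N (suc n) ⟩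
  suc N C suc (suc n)                         ∎
  where
  B₁ B₂ : ℕ
  B₁ = ballot (suc (suc n)) (suc k)
  B₂ = ballot (suc n) (suc (suc (suc k)))
  N≡₁ : N ≡ 2 * suc n + k + 2
  N≡₁ = suc-injective (trans eq
          (solve 2 (λ n k → con 2 :* (con 1 :+ n) :+ (con 1 :+ k) :+ con 2 := con 1 :+ (con 2 :* (con 1 :+ n) :+ k :+ con 2)) refl n k))
  N≡₂ : N ≡ 2 * n + suc (suc k) + 2
  N≡₂ = trans N≡₁
          (solve 2 (λ n k → con 2 :* (con 1 :+ n) :+ k :+ con 2 := con 2 :* n :+ (con 2 :+ k) :+ con 2) refl n k)

C-absorption : ∀ N k → suc k * (suc N C suc k) ≡ suc N * (N C k)
C-absorption zero    zero    = refl
C-absorption zero    (suc k)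
  rewrite k>n⇒nCk≡0 {1} {suc (suc k)} (s≤s (s≤s z≤n)) | k>n⇒nCk≡0 {0} {suc k} z<s = *-zeroʳ (suc (suc k))
C-absorption (suc N) zero    = trans (+-identityʳ _) (trans (nC1≡n (suc (suc N))) (sym (*-identityʳ _)))
C-absorption (suc N) (suc k) = begin
  suc (suc k) * (suc (suc N) C suc (suc k))      ≡⟨ cong (suc (suc k) *_) (sym (pascal (suc N) (suc k))) ⟩
  suc (suc k) * (P + Q)
    ≡⟨ solve 3 (λ k p q → (con 1 :+ k) :* (p :+ q) := (k :* p :+ p) :+ (con 1 :+ k) :* q) refl (suc k) P Q ⟩
  (suc k * P + P) + suc (suc k) * Q
    ≡⟨ cong₂ (λ a b → (a + P) + b) (C-absorption N k) (C-absorption N (suc k)) ⟩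
  (suc N * (N C k) + P) + suc N * (N C suc k)
    ≡⟨ solve 4 (λ n a b p → (n :* a :+ p) :+ n :* b := n :* (a :+ b) :+ p) refl (suc N) (N C k) (N C suc k) P ⟩
  suc N * (N C k + N C suc k) + P                ≡⟨ cong (λ z → suc N * z + P) (pascal N k) ⟩
  suc N * P + P                                  ≡⟨ solve 2 (λ n p → n :* p :+ p := (con 1 :+ n) :* p) refl (suc N) P ⟩
  suc (suc N) * P                                ∎
  where
  P Q : ℕ
  P = suc N C suc k
  Q = suc N C suc (suc k)

C-middle : ∀ n → (2 + n) * ((2 + 2 * n) C n) ≡ suc n * ((2 + 2 * n) C suc n)
C-middle n = begin
  (2 + n) * (suc N C n)
    ≡⟨ cong ((2 + n) *_) (C-sym n (2 + n) (solve 1 (λ n → con 2 :+ con 2 :* n := n :+ (con 2 :+ n)) refl n)) ⟩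
  (2 + n) * (suc N C (2 + n))
    ≡⟨ C-absorption N (suc n) ⟩
  suc N * (N C suc n)
    ≡⟨ cong (suc N *_) (C-sym (suc n) n (solve 1 (λ n → con 1 :+ con 2 :* n := (con 1 :+ n) :+ n) refl n)) ⟩
  suc N * (N C n)
    ≡⟨ sym (C-absorption N n) ⟩
  suc n * (suc N C suc n)        ∎
  where
  N : ℕ
  N = suc (2 * n)

catalan≡ballot : ∀ n → catalan n ≡ ballot n 1
catalan≡ballot zero    = refl
catalan≡ballot (suc n) = begin
  ((2 * suc n) C suc n) / (2 + n)
    ≡⟨ cong (λ N → (N C suc n) / (2 + n)) (solve 1 (λ n → con 2 :* (con 1 :+ n) := con 2 :+ con 2 :* n) refl n) ⟩
  y / (2 + n)
    ≡⟨ cong (_/ (2 + n)) (sym b*[2+n]≡y) ⟩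
  (b * (2 + n)) / (2 + n)
    ≡⟨ m*n/n≡m b (2 + n) ⟩
  b ∎
  where
  b x y : ℕ
  b = ballot (suc n) 1
  x = (2 + 2 * n) C n
  y = (2 + 2 * n) C suc n
  b+x≡y : b + x ≡ y
  b+x≡y = ballot-binomial n 0 (2 + 2 * n) (solve 1 (λ n → con 2 :+ con 2 :* n := con 2 :* n :+ con 0 :+ con 2) refl n)
  b*[2+n]≡y : b * (2 + n) ≡ y
  b*[2+n]≡y = trans (*-comm b (2 + n)) (+-cancelˡ-≡ (suc n * y) _ _ (begin
    suc n * y + (2 + n) * b        ≡⟨ cong (_+ (2 + n) * b) (sym (C-middle n)) ⟩
    (2 + n) * x + (2 + n) * b      ≡⟨ sym (*-distribˡ-+ (2 + n) x b) ⟩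
    (2 + n) * (x + b)              ≡⟨ cong ((2 + n) *_) (trans (+-comm x b) b+x≡y) ⟩
    (2 + n) * y                    ≡⟨ solve 2 (λ n y → (con 2 :+ n) :* y := (con 1 :+ n) :* y :+ y) refl n y ⟩
    suc n * y + y                  ∎))

catalan-segner : ∀ k → catalan (suc k) ≡ ∑[ h < suc k ] (catalan h * catalan (k ∸ h))
catalan-segner k = begin
  catalan (suc k)                                   ≡⟨ catalan≡ballot (suc k) ⟩
  ballot k 2                                        ≡⟨ sym (ballot-convolution k 1) ⟩
  ∑[ h < suc k ] (ballot h 1 * ballot (k ∸ h) 1)
    ≡⟨ ∑<-cong (suc k) (λ {h} _ → sym (cong₂ _*_ (catalan≡ballot h) (catalan≡ballot (k ∸ h)))) ⟩
  ∑[ h < suc k ] (catalan h * catalan (k ∸ h))      ∎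

at-++ˡ : ∀ xs ys {i} → suc i ≤ length xs → at (xs ++ ys) (suc i) ≡ at xs (suc i)
at-++ˡ (x ∷ xs) ys {zero}  _           = refl
at-++ˡ (x ∷ xs) ys {suc i} (s≤s i<len) = at-++ˡ xs ys i<len

at-++ʳ : ∀ xs ys i → at (xs ++ ys) (length xs + suc i) ≡ at ys (suc i)
at-++ʳ []       ys i = refl
at-++ʳ (x ∷ xs) ys i rewrite +-suc (length xs) i =
  trans (cong (at (xs ++ ys)) (sym (+-suc (length xs) i))) (at-++ʳ xs ys i)

All⇒at : ∀ {P : ℕ → Set} {xs} → All P xs → ∀ i → 1 ≤ i → i ≤ length xs → P (at xs i)
All⇒at (px ∷ _)   1             _ _           = px
All⇒at (_  ∷ pxs) (suc (suc i)) _ (s≤s i<len) = All⇒at pxs (suc i) (s≤s z≤n) i<len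

at⇒All : ∀ {P : ℕ → Set} xs → (∀ i → 1 ≤ i → i ≤ length xs → P (at xs i)) → All P xs
at⇒All []       _   = []
at⇒All (x ∷ xs) Pat = Pat 1 (s≤s z≤n) (s≤s z≤n)
                    ∷ at⇒All xs (λ { (suc i) _ i≤len → Pat (suc (suc i)) (s≤s z≤n) (s≤s i≤len) })

AllPairs⇒at : ∀ {R : ℕ → ℕ → Set} {xs} → AllPairs R xs →
              ∀ q r → 1 ≤ q → q < r → r ≤ length xs → R (at xs q) (at xs r)
AllPairs⇒at (Rx ∷ _)   1             (suc (suc r)) _ _         (s≤s r<len) =
  All⇒at Rx (suc r) (s≤s z≤n) r<len
AllPairs⇒at (_  ∷ _)   1             1             _ (s≤s ())  _
AllPairs⇒at (_  ∷ Rxs) (suc (suc q)) (suc (suc r)) _ (s≤s q<r) (s≤s r<len) =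
  AllPairs⇒at Rxs (suc q) (suc r) (s≤s z≤n) q<r r<len

at⇒AllPairs : ∀ {R : ℕ → ℕ → Set} xs →
              (∀ q r → 1 ≤ q → q < r → r ≤ length xs → R (at xs q) (at xs r)) → AllPairs R xs
at⇒AllPairs []       _   = []
at⇒AllPairs (x ∷ xs) Rat =
  at⇒All xs (λ { (suc r) _ r≤len → Rat 1 (suc (suc r)) (s≤s z≤n) (s≤s (s≤s z≤n)) (s≤s r≤len) })
  ∷ at⇒AllPairs xs (λ { (suc q) (suc r) _ (s≤s q<r) r≤len →
                          Rat (suc (suc q)) (suc (suc r)) (s≤s z≤n) (s≤s (s≤s q<r)) (s≤s r≤len) })

range-suc : ∀ a k → range a (suc k) ≡ a ∷ range (suc a) k
range-suc a k = cong₂ _∷_ (+-identityʳ a) (begin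
  map (a +_) (applyUpTo suc k)      ≡⟨ cong (map (a +_)) (sym (map-upTo suc k)) ⟩
  map (a +_) (map suc (upTo k))     ≡⟨ sym (map-∘ (upTo k)) ⟩
  map (λ i → a + suc i) (upTo k)    ≡⟨ map-cong (+-suc a) (upTo k) ⟩
  map (suc a +_) (upTo k)           ∎)

range-++ : ∀ a k l → range a (k + l) ≡ range a k ++ range (a + k) l
range-++ a zero    l = cong (λ b → range b l) (sym (+-identityʳ a))
range-++ a (suc k) l = begin
  range a (suc (k + l))                          ≡⟨ range-suc a (k + l) ⟩
  a ∷ range (suc a) (k + l)                      ≡⟨ cong (a ∷_) (range-++ (suc a) k l) ⟩
  a ∷ range (suc a) k ++ range (suc a + k) l
    ≡⟨ cong₂ _++_ (sym (range-suc a k)) (cong (λ b → range b l) (sym (+-suc a k))) ⟩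
  range a (suc k) ++ range (a + suc k) l         ∎

range-pivot : ∀ d g → range 1 (suc (d + g)) ≡ range 1 d ++ suc d ∷ range (2 + d) g
range-pivot d g = begin
  range 1 (suc (d + g))                   ≡⟨ cong (range 1) (sym (+-suc d g)) ⟩
  range 1 (d + suc g)                     ≡⟨ range-++ 1 d (suc g) ⟩
  range 1 d ++ range (suc d) (suc g)      ≡⟨ cong (range 1 d ++_) (range-suc (suc d) g) ⟩
  range 1 d ++ suc d ∷ range (2 + d) g    ∎

map-+-range : ∀ c a k → map (c +_) (range a k) ≡ range (c + a) k
map-+-range c a k = trans (sym (map-∘ (upTo k))) (map-cong (λ i → sym (+-assoc c a i)) (upTo k))

map-∸-range : ∀ c a k → c ≤ a → map (_∸ c) (range a k) ≡ range (a ∸ c) k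
map-∸-range c a k c≤a = trans (sym (map-∘ (upTo k))) (map-cong (λ i → +-∸-comm i c≤a) (upTo k))

∈-range⁻ : ∀ {a k v} → v ∈ range a k → a ≤ v × v < a + k
∈-range⁻ {a} v∈ with i , i∈ , refl ← ∈-map⁻ (a +_) v∈ = m≤m+n a i , +-monoʳ-< a (∈-upTo⁻ i∈)

All-range : ∀ {P : ℕ → Set} a k → (∀ {v} → a ≤ v → v < a + k → P v) → All P (range a k)
All-range a k P-range = All.tabulate (λ v∈ → let a≤v , v<a+k = ∈-range⁻ v∈ in P-range a≤v v<a+k)

length-range : ∀ a k → length (range a k) ≡ k
length-range a k = trans (length-map (a +_) (upTo k)) (length-upTo k)

range-unique : ∀ a k → Unique (range a k)
range-unique a k = Unique.map⁺ (+-cancelˡ-≡ a _ _) (Unique.upTo⁺ k)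

IsPerm⇒bounded : ∀ {n π} → IsPerm n π → All (λ v → 1 ≤ v × v ≤ n) π
IsPerm⇒bounded {n} p = All-resp-↭ (↭-sym p) (All-range 1 n (λ 1≤v v<1+n → 1≤v , ≤-pred v<1+n))

IsPerm⇒length : ∀ {n π} → IsPerm n π → length π ≡ n
IsPerm⇒length {n} p = trans (↭-length p) (length-range 1 n)

IsPerm⇒unique : ∀ {n π} → IsPerm n π → Unique π
IsPerm⇒unique {n} p = Unique-resp-↭ (↭⇒↭ₛ (↭-sym p)) (range-unique 1 n)

pivot-↭ : ∀ (x : ℕ) ys zs → x ∷ ys ++ zs ↭ zs ++ x ∷ ys
pivot-↭ x ys zs = ↭-trans (↭-prep x (++-comm ys zs)) (↭-sym (shift x zs ys))

filter-below : ∀ x {as bs} → All (_< x) as → All (x <_) bs → filter (_<? x) (as ++ x ∷ bs) ≡ as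
filter-below x {as} {bs} as<x x<bs = begin
  filter (_<? x) (as ++ x ∷ bs)                 ≡⟨ filter-++ (_<? x) as (x ∷ bs) ⟩
  filter (_<? x) as ++ filter (_<? x) (x ∷ bs)
    ≡⟨ cong₂ _++_ (filter-all (_<? x) as<x) (filter-none (_<? x) (<-irrefl refl ∷ All.map <⇒≯ x<bs)) ⟩
  as ++ []                                      ≡⟨ ++-identityʳ as ⟩
  as                                            ∎

filter-above : ∀ x {as bs} → All (_< x) as → All (x <_) bs → filter (x <?_) (as ++ x ∷ bs) ≡ bs
filter-above x {as} {bs} as<x x<bs = begin
  filter (x <?_) (as ++ x ∷ bs)                 ≡⟨ filter-++ (x <?_) as (x ∷ bs) ⟩
  filter (x <?_) as ++ filter (x <?_) (x ∷ bs)
    ≡⟨ cong₂ _++_ (filter-none (x <?_) (All.map <⇒≯ as<x)) (filter-reject (x <?_) (<-irrefl refl)) ⟩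
  filter (x <?_) bs                             ≡⟨ filter-all (x <?_) x<bs ⟩
  bs                                            ∎

↭-pivot⁻ : ∀ x {as bs as′ bs′} → as ++ x ∷ bs ↭ as′ ++ x ∷ bs′ →
           All (_< x) as → All (x <_) bs → All (_< x) as′ → All (x <_) bs′ → as ↭ as′ × bs ↭ bs′
↭-pivot⁻ x {as} {bs} {as′} {bs′} p as<x x<bs as′<x x<bs′ =
  ≡-sandwich (filter-below x as<x x<bs) (filter-↭ (_<? x) p) (filter-below x as′<x x<bs′) ,
  ≡-sandwich (filter-above x as<x x<bs) (filter-↭ (x <?_) p) (filter-above x as′<x x<bs′)
  where
  ≡-sandwich : ∀ {us vs us′ vs′ : List ℕ} → us ≡ vs → us ↭ us′ → us′ ≡ vs′ → vs ↭ vs′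
  ≡-sandwich refl p refl = p

-- Index-free Avoids213: x ∷ xs avoids 213 iff xs does and x is not the “2” of an occurrence.
Avoids213′ : List ℕ → Set
Avoids213′ []       = ⊤
Avoids213′ (x ∷ xs) = AllPairs (λ y z → ¬ (y < x × x < z)) xs × Avoids213′ xs

Avoids213-∷⁻ : ∀ x xs → Avoids213 (x ∷ xs) →
  (∀ q r → 1 ≤ q → q < r → r ≤ length xs → ¬ (at xs q < x × x < at xs r)) × Avoids213 xs
Avoids213-∷⁻ x xs av =
  (λ { (suc q) (suc r) _ q<r r≤len →
         av 1 (suc (suc q)) (suc (suc r)) (s≤s z≤n) (s≤s (s≤s z≤n)) (s≤s q<r) (s≤s r≤len) }) ,
  (λ { (suc p) (suc q) (suc r) _ p<q q<r r≤len →
         av (suc (suc p)) (suc (suc q)) (suc (suc r)) (s≤s z≤n) (s≤s p<q) (s≤s q<r) (s≤s r≤len) })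

Avoids213-∷⁺ : ∀ x xs → (∀ q r → 1 ≤ q → q < r → r ≤ length xs → ¬ (at xs q < x × x < at xs r)) →
               Avoids213 xs → Avoids213 (x ∷ xs)
Avoids213-∷⁺ x xs hd tl 1             (suc (suc q)) (suc (suc r)) _ _         (s≤s q<r) (s≤s r≤len) =
  hd (suc q) (suc r) (s≤s z≤n) q<r r≤len
Avoids213-∷⁺ x xs hd tl 1             1             _             _ (s≤s ()) _         _
Avoids213-∷⁺ x xs hd tl (suc (suc p)) (suc (suc q)) (suc (suc r)) _ (s≤s p<q) (s≤s q<r) (s≤s r≤len) =
  tl (suc p) (suc q) (suc r) (s≤s z≤n) p<q q<r r≤len

Avoids213⇔Avoids213′ : ∀ π → Avoids213 π ⇔ Avoids213′ π
Avoids213⇔Avoids213′ []       = mk⇔ (λ _ → tt) (λ { _ _ _ (suc r) _ _ _ () })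
Avoids213⇔Avoids213′ (x ∷ xs) = mk⇔
  (λ av → let hd , tl = Avoids213-∷⁻ x xs av in at⇒AllPairs xs hd , Equivalence.to (Avoids213⇔Avoids213′ xs) tl)
  (λ { (hd , tl) → Avoids213-∷⁺ x xs (AllPairs⇒at hd) (Equivalence.from (Avoids213⇔Avoids213′ xs) tl) })

AllPairs-fromˡ : ∀ {P : A → Set} {R : A → A → Set} {xs} → All P xs → (∀ {a b} → P a → R a b) → AllPairs R xs
AllPairs-fromˡ                []         _  = []
AllPairs-fromˡ {xs = _ ∷ xs} (pa ∷ pas) PR = All.universal (λ _ → PR pa) xs ∷ AllPairs-fromˡ pas PR

AllPairs-fromʳ : ∀ {Q : A → Set} {R : A → A → Set} {xs} → All Q xs → (∀ {a b} → Q b → R a b) → AllPairs R xs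
AllPairs-fromʳ []         _  = []
AllPairs-fromʳ (qa ∷ qas) QR = All.map QR qas ∷ AllPairs-fromʳ qas QR

AllPairs-++⁻ˡ : ∀ {R : A → A → Set} xs {ys} → AllPairs R (xs ++ ys) → AllPairs R xs
AllPairs-++⁻ˡ []       _           = []
AllPairs-++⁻ˡ (x ∷ xs) (Rx ∷ Rxys) = All.++⁻ˡ xs Rx ∷ AllPairs-++⁻ˡ xs Rxys

Avoids213′-++⁺ : ∀ ys {zs} → All (λ y → All (_< y) zs) ys → Avoids213′ ys → Avoids213′ zs →
                 Avoids213′ (ys ++ zs)
Avoids213′-++⁺ []       _              _         av = av
Avoids213′-++⁺ (y ∷ ys) (zs<y ∷ zs<ys) (hd , tl) av =
  AllPairs.++⁺ hd (AllPairs-fromʳ zs<y below) (All.universal (λ _ → All.map below zs<y) ys) ,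
  Avoids213′-++⁺ ys zs<ys tl av
  where
  below : ∀ {a b} → b < y → ¬ (a < y × y < b)
  below b<y (_ , y<b) = <-asym b<y y<b

Avoids213′-pivot⁺ : ∀ x {ys zs} → All (x <_) ys → All (_< x) zs →
                    Avoids213′ ys → Avoids213′ zs → Avoids213′ (x ∷ ys ++ zs)
Avoids213′-pivot⁺ x {ys} {zs} x<ys zs<x avys avzs =
  AllPairs.++⁺ (AllPairs-fromˡ x<ys above) (AllPairs-fromʳ zs<x below)
               (All.map (λ x<a → All.universal (λ _ → above x<a) zs) x<ys) ,
  Avoids213′-++⁺ ys (All.map (λ x<y → All.map (λ z<x → <-trans z<x x<y) zs<x) x<ys) avys avzs
  where
  above : ∀ {a b} → x < a → ¬ (a < x × x < b)
  above x<a (a<x , _) = <-asym x<a a<x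
  below : ∀ {a b} → b < x → ¬ (a < x × x < b)
  below b<x (_ , x<b) = <-asym b<x x<b

Avoids213′-++⁻ : ∀ ys {zs} → Avoids213′ (ys ++ zs) → Avoids213′ ys × Avoids213′ zs
Avoids213′-++⁻ []       av        = tt , av
Avoids213′-++⁻ (y ∷ ys) (hd , tl) = let avys , avzs = Avoids213′-++⁻ ys tl in
                                    (AllPairs-++⁻ˡ ys hd , avys) , avzs

Avoids213′-map⁺ : ∀ a xs → Avoids213′ xs → Avoids213′ (map (a +_) xs)
Avoids213′-map⁺ a []       _         = tt
Avoids213′-map⁺ a (x ∷ xs) (hd , tl) =
  AllPairs.map⁺ (AllPairs.map (λ ¬213 (a+y<a+x , a+x<a+z) → ¬213 (+-cancelˡ-< a _ _ a+y<a+x , +-cancelˡ-< a _ _ a+x<a+z)) hd) ,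
  Avoids213′-map⁺ a xs tl

Avoids213′-map⁻ : ∀ a xs → Avoids213′ (map (a +_) xs) → Avoids213′ xs
Avoids213′-map⁻ a []       _         = tt
Avoids213′-map⁻ a (x ∷ xs) (hd , tl) =
  AllPairs.map (λ ¬213 (y<x , x<z) → ¬213 (+-monoʳ-< a y<x , +-monoʳ-< a x<z)) (AllPairs.map⁻ hd) ,
  Avoids213′-map⁻ a xs tl

Avoids213′-split : ∀ x xs → All (x ≢_) xs → AllPairs (λ y z → ¬ (y < x × x < z)) xs →
                   ∃₂ λ ys zs → xs ≡ ys ++ zs × All (x <_) ys × All (_< x) zs
Avoids213′-split x []       _              _         = [] , [] , refl , [] , []
Avoids213′-split x (y ∷ xs) (x≢y ∷ x≢xs) (hd ∷ tl) with <-cmp x y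
... | tri< x<y _ _ = let ys , zs , xs≡ , x<ys , zs<x = Avoids213′-split x xs x≢xs tl
                     in y ∷ ys , zs , cong (y ∷_) xs≡ , x<y ∷ x<ys , zs<x
... | tri≈ _ x≡y _ = contradiction x≡y x≢y
... | tri> _ _ y<x = [] , y ∷ xs , refl , [] ,
                     y<x ∷ All.zipWith (λ (x≢z , ¬213) → ≤∧≢⇒< (≮⇒≥ (λ x<z → ¬213 (y<x , x<z))) (x≢z ∘ sym))
                                       (x≢xs , hd)

-- Enumerating 213-avoiders

cartesianProductWith-unique : ∀ (h : A → B → D) {xs ys} →
  (∀ {a b b′} → h a b ≡ h a b′ → b ≡ b′) →
  (∀ {a a′ b b′} → a ∈ xs → a′ ∈ xs → h a b ≡ h a′ b′ → a ≡ a′) →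
  Unique xs → Unique ys → Unique (cartesianProductWith h xs ys)
cartesianProductWith-unique h {[]}     _    _    _            _   = []
cartesianProductWith-unique h {a ∷ xs} {ys} injʳ injˡ (a∉xs ∷ xs!) ys! =
  Unique.++⁺ (Unique.map⁺ injʳ ys!)
             (cartesianProductWith-unique h injʳ (λ a∈ a′∈ → injˡ (there a∈) (there a′∈)) xs! ys!)
             disjoint
  where
  disjoint : Disjoint (map (h a) ys) (cartesianProductWith h xs ys)
  disjoint (v∈ , v∈′) with _ , _ , refl ← ∈-map⁻ (h a) v∈
                      with a′ , _ , a′∈ , _ , eq ← ∈-cartesianProductWith⁻ h xs ys v∈′
    = All.lookup a∉xs a′∈ (injˡ (here refl) (there a′∈) eq)

glue : ℕ → List ℕ → List ℕ → List ℕ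
glue x γ δ = x ∷ map (x +_) γ ++ δ

glue-injectiveʳ : ∀ x γ {δ δ′} → glue x γ δ ≡ glue x γ δ′ → δ ≡ δ′
glue-injectiveʳ x γ eq = ++-cancelˡ (map (x +_) γ) _ _ (∷-injectiveʳ eq)

glue-injectiveˡ : ∀ x {γ γ′ δ δ′} → length γ ≡ length γ′ → glue x γ δ ≡ glue x γ′ δ′ → γ ≡ γ′
glue-injectiveˡ x {[]}    {[]}     _   _  = refl
glue-injectiveˡ x {a ∷ γ} {a′ ∷ γ′} len eq =
  cong₂ _∷_ (+-cancelˡ-≡ x _ _ (∷-injectiveˡ (∷-injectiveʳ eq)))
            (glue-injectiveˡ x (suc-injective len) (cong (x ∷_) (∷-injectiveʳ (∷-injectiveʳ eq))))

IsPerm-glue : ∀ d g {γ δ} → IsPerm g γ → IsPerm d δ → IsPerm (suc (d + g)) (glue (suc d) γ δ)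
IsPerm-glue d g {γ} {δ} pγ pδ =
  ↭-trans (pivot-↭ (suc d) (map (suc d +_) γ) δ)
  (↭-trans (++⁺ pδ (↭-prep (suc d) (map⁺ (suc d +_) pγ)))
           (↭-reflexive (trans (cong (λ r → range 1 d ++ suc d ∷ r) shifted) (sym (range-pivot d g)))))
  where
  shifted : map (suc d +_) (range 1 g) ≡ range (2 + d) g
  shifted = trans (map-+-range (suc d) 1 g) (cong (λ b → range b g) (+-comm (suc d) 1))

IsPerm-unglue : ∀ d g {ys zs} → IsPerm (suc (d + g)) (suc d ∷ ys ++ zs) →
  All (suc d <_) ys → All (_< suc d) zs → IsPerm g (map (_∸ suc d) ys) × IsPerm d zs
IsPerm-unglue d g {ys} {zs} p x<ys zs<x =
  ↭-trans (map⁺ (_∸ suc d) (proj₂ halves)) (↭-reflexive unshifted) , proj₁ halves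
  where
  pivoted : zs ++ suc d ∷ ys ↭ range 1 d ++ suc d ∷ range (2 + d) g
  pivoted = ↭-trans (↭-sym (pivot-↭ (suc d) ys zs)) (↭-trans p (↭-reflexive (range-pivot d g)))
  halves : zs ↭ range 1 d × ys ↭ range (2 + d) g
  halves = ↭-pivot⁻ (suc d) pivoted zs<x x<ys
             (All-range 1 d (λ _ v<1+d → v<1+d)) (All-range (2 + d) g (λ 2+d≤v _ → 2+d≤v))
  unshifted : map (_∸ suc d) (range (2 + d) g) ≡ range 1 g
  unshifted = trans (map-∸-range (suc d) (2 + d) g (n≤1+n _)) (cong (λ b → range b g) (m+n∸n≡m 1 (suc d)))

glue-above : ∀ d {g γ} → IsPerm g γ → All (suc d <_) (map (suc d +_) γ)
glue-above d pγ = All.map⁺ (All.map (λ (1≤v , _) → m<m+n (suc d) 1≤v) (IsPerm⇒bounded pγ))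

glue-below : ∀ {d δ} → IsPerm d δ → All (_< suc d) δ
glue-below pδ = All.map (λ (_ , v≤d) → s≤s v≤d) (IsPerm⇒bounded pδ)

Avoids213′-glue : ∀ d g {γ δ} → IsPerm g γ → IsPerm d δ → Avoids213′ γ → Avoids213′ δ →
                  Avoids213′ (glue (suc d) γ δ)
Avoids213′-glue d g {γ} pγ pδ avγ avδ =
  Avoids213′-pivot⁺ (suc d) (glue-above d pγ) (glue-below pδ) (Avoids213′-map⁺ (suc d) γ avγ) avδ

-- avoiders f n lists Av_n(213) when n < f; the fuel f makes the recursion structural.
-- avoiderBlock f m g lists those of size m + 1 whose first entry m − g + 1 is followed by g larger entries.
avoiders : ℕ → ℕ → List (List ℕ)
avoiderBlock : ℕ → ℕ → ℕ → List (List ℕ)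

avoiders zero    _       = []
avoiders (suc f) zero    = [] ∷ []
avoiders (suc f) (suc m) = concatMap (avoiderBlock f m) (upTo (suc m))

avoiderBlock f m g = cartesianProductWith (glue (suc (m ∸ g))) (avoiders f g) (avoiders f (m ∸ g))

∈-avoiders⁻ : ∀ f m {π} → π ∈ avoiders (suc f) (suc m) →
  ∃ λ g → g ≤ m × ∃₂ λ γ δ → γ ∈ avoiders f g × δ ∈ avoiders f (m ∸ g) × π ≡ glue (suc (m ∸ g)) γ δ
∈-avoiders⁻ f m π∈ with g , g∈ , π∈block ← find (∈-concatMap⁻ (avoiderBlock f m) π∈)
                   with γ , δ , γ∈ , δ∈ , π≡ ← ∈-cartesianProductWith⁻ (glue (suc (m ∸ g))) (avoiders f g) _ π∈block
  = g , ≤-pred (∈-upTo⁻ g∈) , γ , δ , γ∈ , δ∈ , π≡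

∈-avoiders⁺ : ∀ f m d {γ δ} → d ≤ m → γ ∈ avoiders f (m ∸ d) → δ ∈ avoiders f d →
              glue (suc d) γ δ ∈ avoiders (suc f) (suc m)
∈-avoiders⁺ f m d {γ} {δ} d≤m γ∈ δ∈ =
  ∈-concatMap⁺ (avoiderBlock f m) (lose (∈-upTo⁺ (s≤s (m∸n≤m m d)))
    (subst (λ e → glue (suc e) γ δ ∈ avoiderBlock f m (m ∸ d)) m∸[m∸d]≡d
      (∈-cartesianProductWith⁺ (glue (suc (m ∸ (m ∸ d)))) γ∈ (subst (λ e → δ ∈ avoiders f e) (sym m∸[m∸d]≡d) δ∈))))
  where
  m∸[m∸d]≡d : m ∸ (m ∸ d) ≡ d
  m∸[m∸d]≡d = m∸[m∸n]≡n d≤m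

avoiders-sound : ∀ f n {π} → n < f → π ∈ avoiders f n → IsPerm n π × Avoids213′ π
avoiders-sound (suc f) zero    _          (here refl) = ↭-refl , tt
avoiders-sound (suc f) (suc m) (s≤s m<f) π∈
  with g , g≤m , γ , δ , γ∈ , δ∈ , refl ← ∈-avoiders⁻ f m π∈
  with pγ , avγ ← avoiders-sound f g (≤-<-trans g≤m m<f) γ∈
  with pδ , avδ ← avoiders-sound f (m ∸ g) (≤-<-trans (m∸n≤m m g) m<f) δ∈
  = subst (λ n → IsPerm (suc n) (glue (suc (m ∸ g)) γ δ)) (m∸n+n≡m g≤m) (IsPerm-glue (m ∸ g) g pγ pδ) ,
    Avoids213′-glue (m ∸ g) g pγ pδ avγ avδ

avoiders⇒IsPerm : ∀ f n {π} → n < f → π ∈ avoiders f n → IsPerm n π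
avoiders⇒IsPerm f n n<f π∈ = proj₁ (avoiders-sound f n n<f π∈)

avoiderBlock-IsPerm : ∀ f {m g γ δ} → m < f → g ≤ m → γ ∈ avoiders f g → δ ∈ avoiders f (m ∸ g) →
                      IsPerm g γ × IsPerm (m ∸ g) δ
avoiderBlock-IsPerm f {m} {g} m<f g≤m γ∈ δ∈ =
  avoiders⇒IsPerm f g (≤-<-trans g≤m m<f) γ∈ , avoiders⇒IsPerm f (m ∸ g) (≤-<-trans (m∸n≤m m g) m<f) δ∈

avoiders-complete : ∀ f n {π} → n < f → IsPerm n π → Avoids213′ π → π ∈ avoiders f n
avoiders-complete (suc f) zero    {π}      _         p _ rewrite ↭-empty-inv p = here refl
avoiders-complete (suc f) (suc m) {[]}     _         p _ with () ← IsPerm⇒length p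
avoiders-complete (suc f) (suc m) {x ∷ xs} (s≤s m<f) p (hd , tl)
  with x≢xs ∷ _ ← IsPerm⇒unique p
  with (s≤s {n = d} z≤n , s≤s d≤m) ∷ _ ← IsPerm⇒bounded p
  with ys , zs , refl , x<ys , zs<x ← Avoids213′-split x xs x≢xs hd
  with pγ , pzs ← IsPerm-unglue d (m ∸ d) (subst (λ n → IsPerm (suc n) (suc d ∷ ys ++ zs)) (sym (m+[n∸m]≡n d≤m)) p)
                                x<ys zs<x
  with avys , avzs ← Avoids213′-++⁻ ys tl
  = subst (_∈ avoiders (suc f) (suc m)) (cong (λ ys → suc d ∷ ys ++ zs) ys≡)
      (∈-avoiders⁺ f m d d≤m
        (avoiders-complete f (m ∸ d) (≤-<-trans (m∸n≤m m d) m<f) pγ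
           (Avoids213′-map⁻ (suc d) γ (subst Avoids213′ (sym ys≡) avys)))
        (avoiders-complete f d (≤-<-trans d≤m m<f) pzs avzs))
  where
  γ : List ℕ
  γ = map (_∸ suc d) ys
  ys≡ : map (suc d +_) γ ≡ ys
  ys≡ = trans (sym (map-∘ ys)) (map-id-local (All.map (λ x<y → m+[n∸m]≡n (<⇒≤ x<y)) x<ys))

avoiders-unique : ∀ f n → n < f → Unique (avoiders f n)
avoiders-unique (suc f) zero    _         = [] ∷ []
avoiders-unique (suc f) (suc m) (s≤s m<f) =
  Unique.concat⁺ (All.map⁺ (All.applyUpTo⁺₁ _ (suc m) block-unique))
                 (AllPairs.map⁺ (AllPairs.applyUpTo⁺₁ _ (suc m) blocks-disjoint))
  where
  block-unique : ∀ {g} → g < suc m → Unique (avoiderBlock f m g)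
  block-unique {g} (s≤s g≤m) =
    cartesianProductWith-unique (glue (suc (m ∸ g))) (glue-injectiveʳ _ _)
      (λ γ∈ γ′∈ → glue-injectiveˡ _ (trans (length-γ γ∈) (sym (length-γ γ′∈))))
      (avoiders-unique f g (≤-<-trans g≤m m<f)) (avoiders-unique f (m ∸ g) (≤-<-trans (m∸n≤m m g) m<f))
    where
    length-γ : ∀ {γ} → γ ∈ avoiders f g → length γ ≡ g
    length-γ γ∈ = IsPerm⇒length (avoiders⇒IsPerm f g (≤-<-trans g≤m m<f) γ∈)
  -- Blocks are told apart by their first entry m − g + 1.
  blocks-disjoint : ∀ {g g′} → g < g′ → g′ < suc m → Disjoint (avoiderBlock f m g) (avoiderBlock f m g′)
  blocks-disjoint {g} {g′} g<g′ (s≤s g′≤m) (π∈ , π∈′)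
    with _ , _ , _ , _ , refl ← ∈-cartesianProductWith⁻ (glue (suc (m ∸ g))) (avoiders f g) (avoiders f (m ∸ g)) π∈
    with _ , _ , _ , _ , eq   ← ∈-cartesianProductWith⁻ (glue (suc (m ∸ g′))) (avoiders f g′) (avoiders f (m ∸ g′)) π∈′
    = <-irrefl (sym (suc-injective (∷-injectiveˡ eq))) (∸-monoʳ-< g<g′ g′≤m)

sum-avoiders : ∀ f m (F : List ℕ → ℕ) →
  sum (map F (avoiders (suc f) (suc m))) ≡ ∑[ g < suc m ] sum (map F (avoiderBlock f m g))
sum-avoiders f m F =
  trans (sum-map-concat F (map (avoiderBlock f m) (upTo (suc m)))) (cong sum (sym (map-∘ (upTo (suc m)))))

length≡sum : ∀ (xs : List A) → length xs ≡ sum (map (λ _ → 1) xs)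
length≡sum xs = sym (trans (sum-map-const 1 xs) (*-identityʳ (length xs)))

length-avoiders : ∀ f n → n < f → length (avoiders f n) ≡ catalan n
length-avoiders (suc f) zero    _         = refl
length-avoiders (suc f) (suc m) (s≤s m<f) = begin
  length (avoiders (suc f) (suc m))                          ≡⟨ length≡sum (avoiders (suc f) (suc m)) ⟩
  sum (map (λ _ → 1) (avoiders (suc f) (suc m)))             ≡⟨ sum-avoiders f m (λ _ → 1) ⟩
  ∑[ g < suc m ] sum (map (λ _ → 1) (avoiderBlock f m g))    ≡⟨ ∑<-cong (suc m) block-size ⟩
  ∑[ g < suc m ] (catalan g * catalan (m ∸ g))               ≡⟨ sym (catalan-segner m) ⟩
  catalan (suc m)                                            ∎
  where
  block-size : ∀ {g} → g < suc m → sum (map (λ _ → 1) (avoiderBlock f m g)) ≡ catalan g * catalan (m ∸ g)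
  block-size {g} (s≤s g≤m) = begin
    sum (map (λ _ → 1) (avoiderBlock f m g))
      ≡⟨ sum-map-cartesianProductWithˡ (λ _ → 1) (glue (suc (m ∸ g))) (λ _ → 1) (avoiders f g) (avoiders f (m ∸ g)) (λ _ _ → refl) ⟩
    length (avoiders f (m ∸ g)) * sum (map (λ _ → 1) (avoiders f g))
      ≡⟨ cong₂ _*_ (length-avoiders f (m ∸ g) (≤-<-trans (m∸n≤m m g) m<f)) (sym (length≡sum (avoiders f g))) ⟩
    catalan (m ∸ g) * length (avoiders f g)
      ≡⟨ cong (catalan (m ∸ g) *_) (length-avoiders f g (≤-<-trans g≤m m<f)) ⟩
    catalan (m ∸ g) * catalan g
      ≡⟨ *-comm (catalan (m ∸ g)) (catalan g) ⟩
    catalan g * catalan (m ∸ g) ∎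

-- Peaks

<ᵇ-true : ∀ {m n} → m < n → (m <ᵇ n) ≡ true
<ᵇ-true m<n = Equivalence.to T-≡ (<⇒<ᵇ m<n)

<ᵇ-false : ∀ {m n} → n ≤ m → (m <ᵇ n) ≡ false
<ᵇ-false {m} {n} n≤m = ¬-not (λ m<ᵇn → ≤⇒≯ n≤m (<ᵇ⇒< m n (Equivalence.from T-≡ m<ᵇn)))

+-<ᵇ : ∀ a m n → (a + m <ᵇ a + n) ≡ (m <ᵇ n)
+-<ᵇ zero    m n = refl
+-<ᵇ (suc a) m n = +-<ᵇ a m n

headOr : ℕ → List ℕ → ℕ
headOr r []      = r
headOr r (y ∷ _) = y

lastOr : ℕ → List ℕ → ℕ
lastOr l []       = l
lastOr l (x ∷ xs) = lastOr x xs

-- peakFlags l xs r has a 1 exactly at the peaks of xs, read with l just before xs and r just after it.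
peakFlags : ℕ → List ℕ → ℕ → List ℕ
peakFlags l []       r = []
peakFlags l (x ∷ xs) r = b2n ((l <ᵇ x) ∧ (headOr r xs <ᵇ x)) ∷ peakFlags x xs r

peaks : List ℕ → List ℕ
peaks π = peakFlags 0 π 0

isPeak : List ℕ → ℕ → Bool
isPeak π i = (at π (i ∸ 1) <ᵇ at π i) ∧ (at π (suc i) <ᵇ at π i)

at-peakFlags : ∀ l xs i → at (peakFlags l xs 0) (suc i) ≡ b2n (isPeak (l ∷ xs) (suc (suc i)))
at-peakFlags l []           i       = refl
at-peakFlags l (x ∷ [])     zero    = refl
at-peakFlags l (x ∷ y ∷ xs) zero    = refl
at-peakFlags l (x ∷ xs)     (suc i) = at-peakFlags x xs i

at-peaks : ∀ π i → at (peaks π) i ≡ b2n (isPeak π i)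
at-peaks []      i             = refl
at-peaks (x ∷ π) zero          = refl
at-peaks (x ∷ π) (suc zero)    = at-peakFlags 0 (x ∷ π) 0
at-peaks (x ∷ π) (suc (suc i)) = at-peakFlags 0 (x ∷ π) (suc i)

length-peakFlags : ∀ l xs r → length (peakFlags l xs r) ≡ length xs
length-peakFlags l []       r = refl
length-peakFlags l (x ∷ xs) r = cong suc (length-peakFlags x xs r)

peakFlags-++ : ∀ l xs ys r → peakFlags l (xs ++ ys) r ≡ peakFlags l xs (headOr r ys) ++ peakFlags (lastOr l xs) ys r
peakFlags-++ l []       ys r = refl
peakFlags-++ l (x ∷ xs) ys r = cong₂ _∷_ (cong (λ h → b2n ((l <ᵇ x) ∧ (h <ᵇ x))) (headOr-++ xs)) (peakFlags-++ x xs ys r)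
  where
  headOr-++ : ∀ xs → headOr r (xs ++ ys) ≡ headOr (headOr r ys) xs
  headOr-++ []      = refl
  headOr-++ (_ ∷ _) = refl

peakFlags-+ : ∀ a l xs r → peakFlags (a + l) (map (a +_) xs) (a + r) ≡ peakFlags l xs r
peakFlags-+ a l []       r = refl
peakFlags-+ a l (x ∷ xs) r =
  cong₂ _∷_ (cong₂ (λ u v → b2n (u ∧ v)) (+-<ᵇ a l x) (trans (cong (_<ᵇ a + x) (headOr-map xs)) (+-<ᵇ a (headOr r xs) x)))
            (peakFlags-+ a x xs r)
  where
  headOr-map : ∀ xs → headOr (a + r) (map (a +_) xs) ≡ a + headOr r xs
  headOr-map []      = refl
  headOr-map (_ ∷ _) = refl

peakFlags-right : ∀ l xs {r r′} → All (r <_) xs → All (r′ <_) xs → peakFlags l xs r ≡ peakFlags l xs r′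
peakFlags-right l []           _               _                 = refl
peakFlags-right l (x ∷ [])     (r<x ∷ [])      (r′<x ∷ [])       =
  cong (λ b → b2n ((l <ᵇ x) ∧ b) ∷ []) (trans (<ᵇ-true r<x) (sym (<ᵇ-true r′<x)))
peakFlags-right l (x ∷ y ∷ xs) (_ ∷ r<y∷xs)   (_ ∷ r′<y∷xs)     =
  cong (b2n ((l <ᵇ x) ∧ (y <ᵇ x)) ∷_) (peakFlags-right x (y ∷ xs) r<y∷xs r′<y∷xs)

peakFlags-shift : ∀ a xs → peakFlags a (map (a +_) xs) a ≡ peaks xs
peakFlags-shift a xs = subst (λ b → peakFlags b (map (a +_) xs) b ≡ peaks xs) (+-identityʳ a) (peakFlags-+ a 0 xs 0)

peakFlags-left : ∀ {l x} xs r → x < l → peakFlags l (x ∷ xs) r ≡ 0 ∷ peakFlags x xs r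
peakFlags-left xs r x<l rewrite <ᵇ-false (<⇒≤ x<l) = refl

lastOr-≥ : ∀ {a} l xs → a ≤ l → All (a ≤_) xs → a ≤ lastOr l xs
lastOr-≥ l []       a≤l _            = a≤l
lastOr-≥ l (x ∷ xs) _   (a≤x ∷ a≤xs) = lastOr-≥ x xs a≤x a≤xs

clearHead : List ℕ → List ℕ
clearHead []       = []
clearHead (_ ∷ fs) = 0 ∷ fs

-- The first entry is a peak iff γ is empty; the shifted γ keeps its peaks, since its outside neighbours
-- are smaller; the first entry of δ follows a larger entry, so it is never a peak.
peaks-glue : ∀ d {g γ δ} → IsPerm g γ → IsPerm d δ →
             peaks (glue (suc d) γ δ) ≡ b2n (null γ) ∷ peaks γ ++ clearHead (peaks δ)
peaks-glue d {g} {γ} {δ} pγ pδ = cong₂ _∷_ (cong b2n (first γ)) (begin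
  peakFlags x (γ⁺ ++ δ) 0                                        ≡⟨ peakFlags-++ x γ⁺ δ 0 ⟩
  peakFlags x γ⁺ (headOr 0 δ) ++ peakFlags (lastOr x γ⁺) δ 0     ≡⟨ cong₂ _++_ middle (last δ δ<x) ⟩
  peaks γ ++ clearHead (peaks δ)                                 ∎)
  where
  x : ℕ
  x = suc d
  γ⁺ : List ℕ
  γ⁺ = map (x +_) γ
  δ<x : All (_< x) δ
  δ<x = glue-below pδ
  x<γ⁺ : All (x <_) γ⁺
  x<γ⁺ = glue-above d pγ
  headOr-< : ∀ zs → All (_< x) zs → headOr 0 zs < x
  headOr-< []      _         = z<s
  headOr-< (_ ∷ _) (z<x ∷ _) = z<x
  headOr-δ<x : headOr 0 δ < x
  headOr-δ<x = headOr-< δ δ<x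
  first : ∀ ys → (headOr 0 (map (x +_) ys ++ δ) <ᵇ x) ≡ null ys
  first []      = <ᵇ-true headOr-δ<x
  first (y ∷ _) = <ᵇ-false (m≤m+n x y)
  middle : peakFlags x γ⁺ (headOr 0 δ) ≡ peaks γ
  middle = trans (peakFlags-right x γ⁺ (All.map (<-trans headOr-δ<x) x<γ⁺) x<γ⁺) (peakFlags-shift x γ)
  last : ∀ zs → All (_< x) zs → peakFlags (lastOr x γ⁺) zs 0 ≡ clearHead (peaks zs)
  last []       _         = refl
  last (z ∷ zs) (z<x ∷ _) = peakFlags-left zs 0 (<-≤-trans z<x (lastOr-≥ x γ⁺ ≤-refl (All.map <⇒≤ x<γ⁺)))

peakAt : ℕ → List ℕ → ℕ
peakAt i π = at (peaks π) i

module _ (d : ℕ) {g γ δ} (pγ : IsPerm g γ) (pδ : IsPerm d δ) where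

  private
    length-peaks-γ : length (peaks γ) ≡ g
    length-peaks-γ = trans (length-peakFlags 0 γ 0) (IsPerm⇒length pγ)

  peakAt-glue-first : peakAt 1 (glue (suc d) γ δ) ≡ b2n (null γ)
  peakAt-glue-first = cong (λ fs → at fs 1) (peaks-glue d pγ pδ)

  peakAt-glue-above : ∀ {j} → j < g → peakAt (2 + j) (glue (suc d) γ δ) ≡ peakAt (suc j) γ
  peakAt-glue-above {j} j<g = trans (cong (λ fs → at fs (2 + j)) (peaks-glue d pγ pδ))
                                    (at-++ˡ (peaks γ) (clearHead (peaks δ)) (subst (j <_) (sym length-peaks-γ) j<g))

  peakAt-glue-beyond : ∀ i → peakAt (2 + (g + i)) (glue (suc d) γ δ) ≡ at (clearHead (peaks δ)) (suc i)
  peakAt-glue-beyond i = begin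
    peakAt (2 + (g + i)) (glue (suc d) γ δ)
      ≡⟨ cong (λ fs → at fs (2 + (g + i))) (peaks-glue d pγ pδ) ⟩
    at (peaks γ ++ clearHead (peaks δ)) (suc (g + i))
      ≡⟨ cong (at (peaks γ ++ clearHead (peaks δ))) (trans (sym (+-suc g i)) (cong (_+ suc i) (sym length-peaks-γ))) ⟩
    at (peaks γ ++ clearHead (peaks δ)) (length (peaks γ) + suc i)
      ≡⟨ at-++ʳ (peaks γ) (clearHead (peaks δ)) i ⟩
    at (clearHead (peaks δ)) (suc i) ∎

  peakAt-glue-pivot : peakAt (2 + g) (glue (suc d) γ δ) ≡ 0
  peakAt-glue-pivot = trans (cong (λ i → peakAt (2 + i) (glue (suc d) γ δ)) (sym (+-identityʳ g)))
                            (trans (peakAt-glue-beyond 0) (at-clearHead-1 (peaks δ)))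
    where
    at-clearHead-1 : ∀ fs → at (clearHead fs) 1 ≡ 0
    at-clearHead-1 []      = refl
    at-clearHead-1 (_ ∷ _) = refl

  peakAt-glue-below : ∀ t → peakAt (3 + (g + t)) (glue (suc d) γ δ) ≡ peakAt (2 + t) δ
  peakAt-glue-below t = begin
    peakAt (3 + (g + t)) (glue (suc d) γ δ)     ≡⟨ cong (λ i → peakAt (2 + i) (glue (suc d) γ δ)) (sym (+-suc g t)) ⟩
    peakAt (2 + (g + suc t)) (glue (suc d) γ δ) ≡⟨ peakAt-glue-beyond (suc t) ⟩
    at (clearHead (peaks δ)) (2 + t)            ≡⟨ at-clearHead-2+ (peaks δ) ⟩
    peakAt (2 + t) δ                            ∎
    where
    at-clearHead-2+ : ∀ fs → at (clearHead fs) (2 + t) ≡ at fs (2 + t)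
    at-clearHead-2+ []      = refl
    at-clearHead-2+ (_ ∷ _) = refl

-- The number of avoiders in avoiderBlock f m g with a peak at position j + 2: the peak lies either in the
-- block of g larger entries or among the m − g smaller ones, never at the pivot position g + 2.
blockPeakCount : ℕ → ℕ → ℕ → ℕ
blockPeakCount j m g = b2n (j <ᵇ g) * (catalan (m ∸ g) * catalan (g ∸ 1)) + b2n (g <ᵇ j) * (catalan g * catalan (m ∸ g ∸ 1))

blockPeakCount-< : ∀ {j g} m → j < g → blockPeakCount j m g ≡ catalan (m ∸ g) * catalan (g ∸ 1)
blockPeakCount-< m j<g rewrite <ᵇ-true j<g | <ᵇ-false (<⇒≤ j<g) = trans (+-identityʳ _) (+-identityʳ _)

blockPeakCount-≡ : ∀ g m → blockPeakCount g m g ≡ 0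
blockPeakCount-≡ g m rewrite <ᵇ-false (≤-refl {g}) = refl

blockPeakCount-> : ∀ {j g} m → g < j → blockPeakCount j m g ≡ catalan g * catalan (m ∸ g ∸ 1)
blockPeakCount-> m g<j rewrite <ᵇ-false (<⇒≤ g<j) | <ᵇ-true g<j = +-identityʳ _

-- Shifting the first sum by one aligns the two kinds of peaks into the Segner convolution.
∑-blockPeakCount : ∀ j k → j ≤ k → ∑[ g < suc (suc k) ] blockPeakCount j (suc k) g ≡ catalan (suc k)
∑-blockPeakCount j k j≤k = begin
  ∑[ g < suc (suc k) ] (above g + below g)                 ≡⟨ sum-map-+ above below (upTo (suc (suc k))) ⟩
  ∑[ g < suc (suc k) ] above g + ∑[ g < suc (suc k) ] below g
    ≡⟨ cong₂ _+_ (∑<-head (suc k) above) (∑<-suc (suc k) below) ⟩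
  ∑[ h < suc k ] above (suc h) + (∑[ h < suc k ] below h + below (suc k))
    ≡⟨ cong (λ b → ∑[ h < suc k ] above (suc h) + (∑[ h < suc k ] below h + b * _))
            (cong b2n (<ᵇ-false (m≤n⇒m≤1+n j≤k))) ⟩
  ∑[ h < suc k ] above (suc h) + (∑[ h < suc k ] below h + 0)
    ≡⟨ cong (∑[ h < suc k ] above (suc h) +_) (+-identityʳ _) ⟩
  ∑[ h < suc k ] above (suc h) + ∑[ h < suc k ] below h    ≡⟨ sym (sum-map-+ (above ∘ suc) below (upTo (suc k))) ⟩
  ∑[ h < suc k ] (above (suc h) + below h)                 ≡⟨ ∑<-cong (suc k) segner-term ⟩
  ∑[ h < suc k ] (catalan h * catalan (k ∸ h))             ≡⟨ sym (catalan-segner k) ⟩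
  catalan (suc k)                                          ∎
  where
  above below : ℕ → ℕ
  above g = b2n (j <ᵇ g) * (catalan (suc k ∸ g) * catalan (g ∸ 1))
  below g = b2n (g <ᵇ j) * (catalan g * catalan (suc k ∸ g ∸ 1))
  segner-term : ∀ {h} → h < suc k → above (suc h) + below h ≡ catalan h * catalan (k ∸ h)
  segner-term {h} (s≤s h≤k) with ≤-<-connex j h
  ... | inj₁ j≤h rewrite <ᵇ-true (s≤s j≤h) | <ᵇ-false j≤h =
    trans (+-identityʳ _) (trans (+-identityʳ _) (*-comm (catalan (k ∸ h)) (catalan h)))
  ... | inj₂ h<j rewrite <ᵇ-false h<j | <ᵇ-true h<j | +-∸-assoc 1 h≤k = +-identityʳ _

first-peak-count : ∀ f m → m < f → sum (map (peakAt 1) (avoiders (suc f) (suc m))) ≡ catalan m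
first-peak-count f m m<f = begin
  sum (map (peakAt 1) (avoiders (suc f) (suc m)))                   ≡⟨ sum-avoiders f m (peakAt 1) ⟩
  ∑[ g < suc m ] sum (map (peakAt 1) (avoiderBlock f m g))
    ≡⟨ ∑<-head m (λ g → sum (map (peakAt 1) (avoiderBlock f m g))) ⟩
  sum (map (peakAt 1) (avoiderBlock f m 0)) + ∑[ g < m ] sum (map (peakAt 1) (avoiderBlock f m (suc g)))
    ≡⟨ cong₂ _+_ first-block (∑<-zero m later-block) ⟩
  catalan m * 1 + 0                                                 ≡⟨ trans (+-identityʳ _) (*-identityʳ _) ⟩
  catalan m                                                         ∎
  where
  first-block : sum (map (peakAt 1) (avoiderBlock f m 0)) ≡ catalan m * 1
  first-block = begin
    sum (map (peakAt 1) (avoiderBlock f m 0))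
      ≡⟨ sum-map-cartesianProductWithˡ (peakAt 1) (glue (suc m)) (λ _ → 1) (avoiders f 0) (avoiders f m) peak-at-first ⟩
    length (avoiders f m) * sum (map (λ _ → 1) (avoiders f 0))
      ≡⟨ cong₂ _*_ (length-avoiders f m m<f) (sym (length≡sum (avoiders f 0))) ⟩
    catalan m * length (avoiders f 0)
      ≡⟨ cong (catalan m *_) (length-avoiders f 0 (≤-<-trans z≤n m<f)) ⟩
    catalan m * 1 ∎
    where
    peak-at-first : ∀ {γ δ} → γ ∈ avoiders f 0 → δ ∈ avoiders f m → peakAt 1 (glue (suc m) γ δ) ≡ 1
    peak-at-first γ∈ δ∈ with pγ , pδ ← avoiderBlock-IsPerm f m<f z≤n γ∈ δ∈ =
      trans (peakAt-glue-first m pγ pδ) (cong (b2n ∘ null) (↭-empty-inv pγ))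
  later-block : ∀ {g} → g < m → sum (map (peakAt 1) (avoiderBlock f m (suc g))) ≡ 0
  later-block {g} g<m = sum-map-zero (avoiderBlock f m (suc g)) λ π∈ →
    let γ , δ , γ∈ , δ∈ , π≡ = ∈-cartesianProductWith⁻ (glue (suc (m ∸ suc g))) (avoiders f (suc g)) (avoiders f (m ∸ suc g)) π∈
        pγ , pδ = avoiderBlock-IsPerm f m<f g<m γ∈ δ∈
    in trans (cong (peakAt 1) π≡) (trans (peakAt-glue-first (m ∸ suc g) pγ pδ) (cong b2n (nonempty pγ)))
    where
    nonempty : ∀ {γ} → IsPerm (suc g) γ → null γ ≡ false
    nonempty {γ} pγ with γ | IsPerm⇒length pγ
    ... | _ ∷ _ | _ = refl

PeakCount : ℕ → Set
PeakCount f = ∀ n → n < f → ∀ {i} → 1 ≤ i → i ≤ n → sum (map (peakAt i) (avoiders f n)) ≡ catalan (n ∸ 1)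

module _ {f m g} (m<f : m < f) (g≤m : g ≤ m) where

  private
    parts : ∀ {γ δ} → γ ∈ avoiders f g → δ ∈ avoiders f (m ∸ g) → IsPerm g γ × IsPerm (m ∸ g) δ
    parts = avoiderBlock-IsPerm f m<f g≤m

  block-peaks-above : PeakCount f → ∀ {j} → j < g →
    sum (map (peakAt (2 + j)) (avoiderBlock f m g)) ≡ catalan (m ∸ g) * catalan (g ∸ 1)
  block-peaks-above IH {j} j<g = begin
    sum (map (peakAt (2 + j)) (avoiderBlock f m g))
      ≡⟨ sum-map-cartesianProductWithˡ (peakAt (2 + j)) (glue (suc (m ∸ g))) (peakAt (suc j)) (avoiders f g) (avoiders f (m ∸ g))
           (λ γ∈ δ∈ → let pγ , pδ = parts γ∈ δ∈ in peakAt-glue-above (m ∸ g) pγ pδ j<g) ⟩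
    length (avoiders f (m ∸ g)) * sum (map (peakAt (suc j)) (avoiders f g))
      ≡⟨ cong₂ _*_ (length-avoiders f (m ∸ g) (≤-<-trans (m∸n≤m m g) m<f)) (IH g (≤-<-trans g≤m m<f) (s≤s z≤n) j<g) ⟩
    catalan (m ∸ g) * catalan (g ∸ 1) ∎

  block-peaks-pivot : sum (map (peakAt (2 + g)) (avoiderBlock f m g)) ≡ 0
  block-peaks-pivot = sum-map-zero (avoiderBlock f m g) λ π∈ →
    let γ , δ , γ∈ , δ∈ , π≡ = ∈-cartesianProductWith⁻ (glue (suc (m ∸ g))) (avoiders f g) (avoiders f (m ∸ g)) π∈
        pγ , pδ = parts γ∈ δ∈
    in trans (cong (peakAt (2 + g)) π≡) (peakAt-glue-pivot (m ∸ g) pγ pδ)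

  block-peaks-below : PeakCount f → ∀ t → 2 + t ≤ m ∸ g →
    sum (map (peakAt (3 + (g + t))) (avoiderBlock f m g)) ≡ catalan g * catalan (m ∸ g ∸ 1)
  block-peaks-below IH t 2+t≤m∸g = begin
    sum (map (peakAt (3 + (g + t))) (avoiderBlock f m g))
      ≡⟨ sum-map-cartesianProductWithʳ (peakAt (3 + (g + t))) (glue (suc (m ∸ g))) (peakAt (2 + t)) (avoiders f g) (avoiders f (m ∸ g))
           (λ γ∈ δ∈ → let pγ , pδ = parts γ∈ δ∈ in peakAt-glue-below (m ∸ g) pγ pδ t) ⟩
    length (avoiders f g) * sum (map (peakAt (2 + t)) (avoiders f (m ∸ g)))
      ≡⟨ cong₂ _*_ (length-avoiders f g (≤-<-trans g≤m m<f)) (IH (m ∸ g) (≤-<-trans (m∸n≤m m g) m<f) (s≤s z≤n) 2+t≤m∸g) ⟩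
    catalan g * catalan (m ∸ g ∸ 1) ∎

peak-count : ∀ f → PeakCount f
peak-count (suc f) (suc m)       (s≤s m<f) {1}           _ _                = first-peak-count f m m<f
peak-count (suc f) (suc (suc k)) (s≤s m<f) {suc (suc j)} _ (s≤s (s≤s j≤k)) = begin
  sum (map (peakAt (2 + j)) (avoiders (suc f) (suc m)))             ≡⟨ sum-avoiders f m (peakAt (2 + j)) ⟩
  ∑[ g < suc m ] sum (map (peakAt (2 + j)) (avoiderBlock f m g))    ≡⟨ ∑<-cong (suc m) block ⟩
  ∑[ g < suc m ] blockPeakCount j m g                               ≡⟨ ∑-blockPeakCount j k j≤k ⟩
  catalan m                                                         ∎
  where
  m : ℕ
  m = suc k
  block : ∀ {g} → g < suc m → sum (map (peakAt (2 + j)) (avoiderBlock f m g)) ≡ blockPeakCount j m g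
  block {g} (s≤s g≤m) with <-cmp j g
  ... | tri< j<g _ _  = trans (block-peaks-above m<f g≤m (peak-count f) j<g) (sym (blockPeakCount-< m j<g))
  ... | tri≈ _ refl _ = trans (block-peaks-pivot m<f g≤m) (sym (blockPeakCount-≡ g m))
  ... | tri> _ _ g<j with t , refl ← m≤n⇒∃[o]m+o≡n g<j =
    trans (block-peaks-below m<f g≤m (peak-count f) t 2+t≤m∸g) (sym (blockPeakCount-> m g<j))
    where
    2+t≤m∸g : 2 + t ≤ m ∸ g
    2+t≤m∸g = m+n≤o⇒m≤o∸n (2 + t) (subst (_≤ m) (cong (suc ∘ suc) (+-comm g t)) (s≤s j≤k))

-- Degree-one vertices

≤ᵇ-true : ∀ {m n} → m ≤ n → (m ≤ᵇ n) ≡ true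
≤ᵇ-true m≤n = Equivalence.to T-≡ (≤⇒≤ᵇ m≤n)

cellDegree : ℕ → ℕ → ℕ → ℕ → ℕ
cellDegree u v w j = b2n ((1 ≤ᵇ j ∸ 1) ∧ (j ∸ 1 ≤ᵇ v)) + b2n ((1 ≤ᵇ suc j) ∧ (suc j ≤ᵇ v))
                   + b2n ((1 ≤ᵇ j) ∧ (j ≤ᵇ u)) + b2n ((1 ≤ᵇ j) ∧ (j ≤ᵇ w))

degree≡cellDegree : ∀ π {i} j → 2 ≤ i → i < length π →
                    degree π i j ≡ cellDegree (at π (i ∸ 1)) (at π i) (at π (suc i)) j
degree≡cellDegree π {suc (suc i)} j (s≤s (s≤s z≤n)) i<len
  rewrite ≤ᵇ-true (<⇒≤ i<len) | ≤ᵇ-true (<⇒≤ (<-trans (n<1+n _) i<len)) | ≤ᵇ-true i<len = refl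

cellDegree-below : ∀ {u v w j} → 1 ≤ u → 1 ≤ j → j ≤ v → b2n (cellDegree u (suc v) w j ≡ᵇ 1) ≡ 0
cellDegree-below {j = 1}           1≤u _ 1≤v rewrite <ᵇ-true 1≤u | <ᵇ-true 1≤v = refl
cellDegree-below {v = v} {j = suc (suc j)} _ _ 2+j≤v
  rewrite <ᵇ-true (m<n⇒m<1+n (<-trans (n<1+n j) 2+j≤v)) | <ᵇ-true 2+j≤v = refl

cellDegree-top : ∀ {u w} v → 1 ≤ u → 1 ≤ w →
                 b2n (cellDegree u (suc v) w (suc v) ≡ᵇ 1) ≡ b2n ((u <ᵇ suc v) ∧ (w <ᵇ suc v))
cellDegree-top zero    1≤u 1≤w rewrite <ᵇ-true 1≤u | <ᵇ-true 1≤w | <ᵇ-false 1≤u = refl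
cellDegree-top {u} {w} (suc v) _ _ rewrite <ᵇ-true (m<n⇒m<1+n (n<1+n v)) | <ᵇ-false (≤-refl {v})
  with ≤-<-connex u (suc v)
... | inj₂ 1+v<u rewrite <ᵇ-true 1+v<u | <ᵇ-false 1+v<u = refl
... | inj₁ u≤1+v rewrite <ᵇ-false u≤1+v | <ᵇ-true (s≤s u≤1+v) with ≤-<-connex w (suc v)
...   | inj₁ w≤1+v rewrite <ᵇ-false w≤1+v | <ᵇ-true (s≤s w≤1+v) = refl
...   | inj₂ 1+v<w rewrite <ᵇ-true 1+v<w | <ᵇ-false 1+v<w = refl

-- Only the top cell of a column can have degree one, and it does iff both neighbouring columns are lower.
column-deg1-count : ∀ {u w} v → 1 ≤ u → 1 ≤ w →
  sum (map (λ j → b2n (cellDegree u v w j ≡ᵇ 1)) (range 1 v)) ≡ b2n ((u <ᵇ v) ∧ (w <ᵇ v))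
column-deg1-count zero    _   _   = refl
column-deg1-count {u} {w} (suc v) 1≤u 1≤w = begin
  sum (map F (range 1 (suc v)))                              ≡⟨ cong (sum ∘ map F) range-1+v ⟩
  sum (map F (range 1 v ++ suc v ∷ []))                      ≡⟨ cong sum (map-++ F (range 1 v) (suc v ∷ [])) ⟩
  sum (map F (range 1 v) ++ F (suc v) ∷ [])                  ≡⟨ sum-++ (map F (range 1 v)) (F (suc v) ∷ []) ⟩
  sum (map F (range 1 v)) + (F (suc v) + 0)                  ≡⟨ cong₂ _+_ (sum-map-zero (range 1 v) below) (+-identityʳ (F (suc v))) ⟩
  F (suc v)                                                  ≡⟨ cellDegree-top v 1≤u 1≤w ⟩
  b2n ((u <ᵇ suc v) ∧ (w <ᵇ suc v))                          ∎
  where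
  F : ℕ → ℕ
  F j = b2n (cellDegree u (suc v) w j ≡ᵇ 1)
  range-1+v : range 1 (suc v) ≡ range 1 v ++ suc v ∷ []
  range-1+v = trans (cong (range 1) (+-comm 1 v)) (trans (range-++ 1 v 1) (cong (range 1 v ++_) (range-suc (suc v) 0)))
  below : ∀ {j} → j ∈ range 1 v → F j ≡ 0
  below j∈ = let 1≤j , j<1+v = ∈-range⁻ j∈ in cellDegree-below 1≤u 1≤j (≤-pred j<1+v)

deg1-column : ∀ {π i} → All (1 ≤_) π → 2 ≤ i → i < length π →
  sum (map (λ j → b2n (degree π i j ≡ᵇ 1)) (range 1 (at π i))) ≡ peakAt i π
deg1-column {π} {i} π≥1 2≤i@(s≤s 1≤i) i<len = begin
  sum (map (λ j → b2n (degree π i j ≡ᵇ 1)) (range 1 (at π i)))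
    ≡⟨ sum-map-cong (range 1 (at π i)) (λ {j} _ → cong (λ d → b2n (d ≡ᵇ 1)) (degree≡cellDegree π j 2≤i i<len)) ⟩
  sum (map (λ j → b2n (cellDegree (at π (i ∸ 1)) (at π i) (at π (suc i)) j ≡ᵇ 1)) (range 1 (at π i)))
    ≡⟨ column-deg1-count (at π i) (All⇒at π≥1 (i ∸ 1) 1≤i (≤-trans (m∸n≤m i 1) (<⇒≤ i<len)))
                                  (All⇒at π≥1 (suc i) (s≤s z≤n) i<len) ⟩
  b2n (isPeak π i)
    ≡⟨ sym (at-peaks π i) ⟩
  peakAt i π ∎

internal-column : ∀ {i n} → i ∈ range 2 (n ∸ 2) → 2 ≤ i × i < n
internal-column {n = suc (suc n)} i∈ = ∈-range⁻ i∈

deg1Internal≡∑peaks : ∀ {n π} → IsPerm n π → deg1Internal π ≡ sum (map (λ i → peakAt i π) (range 2 (n ∸ 2)))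
deg1Internal≡∑peaks {π = π} p with refl ← IsPerm⇒length p = sum-map-cong (range 2 (length π ∸ 2)) λ i∈ →
  let 2≤i , i<len = internal-column i∈ in deg1-column (All.map proj₁ (IsPerm⇒bounded p)) 2≤i i<len

enumeration↭avoiders : ∀ n {L} → Unique L → (∀ π → (π ∈ L) ⇔ (IsPerm n π × Avoids213 π)) →
                       L ↭ avoiders (suc n) n
enumeration↭avoiders n {L} L! L⇔ =
  ∼bag⇒↭ (unique∧set⇒bag L! (avoiders-unique (suc n) n ≤-refl) (λ {π} → mk⇔ (to π) (from π)))
  where
  to : ∀ π → π ∈ L → π ∈ avoiders (suc n) n
  to π π∈ = let p , av = Equivalence.to (L⇔ π) π∈ in
            avoiders-complete (suc n) n ≤-refl p (Equivalence.to (Avoids213⇔Avoids213′ π) av)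
  from : ∀ π → π ∈ avoiders (suc n) n → π ∈ L
  from π π∈ = let p , av = avoiders-sound (suc n) n ≤-refl π∈ in
              Equivalence.from (L⇔ π) (p , Equivalence.from (Avoids213⇔Avoids213′ π) av)

peak-count-enumeration : ∀ n {L} → Unique L → (∀ π → (π ∈ L) ⇔ (IsPerm n π × Avoids213 π)) →
  ∀ {i} → 1 ≤ i → i ≤ n → sum (map (peakAt i) L) ≡ catalan (n ∸ 1)
peak-count-enumeration n L! L⇔ {i} 1≤i i≤n =
  trans (sum-↭ (map⁺ (peakAt i) (enumeration↭avoiders n L! L⇔))) (peak-count (suc n) n ≤-refl 1≤i i≤n)

lemma6p4 : (n : ℕ) → 3 ≤ n → (L : List (List ℕ)) → Unique L →
    (∀ π → (π ∈ L) ⇔ (IsPerm n π × Avoids213 π)) →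
    sum (map deg1Internal L) ≡ (n ∸ 2) * catalan (n ∸ 1)
lemma6p4 n _ L L! L⇔ = begin
  sum (map deg1Internal L)                             ≡⟨ sum-map-cong L columns-to-peaks ⟩
  sum (map (λ π → sum (map (λ i → peakAt i π) I)) L)   ≡⟨ sum-map-swap (λ π i → peakAt i π) L I ⟩
  sum (map (λ i → sum (map (peakAt i) L)) I)           ≡⟨ sum-map-cong I peaks-at ⟩
  sum (map (λ _ → catalan (n ∸ 1)) I)                  ≡⟨ sum-map-const (catalan (n ∸ 1)) I ⟩
  length I * catalan (n ∸ 1)                           ≡⟨ cong (_* catalan (n ∸ 1)) (length-range 2 (n ∸ 2)) ⟩
  (n ∸ 2) * catalan (n ∸ 1)                            ∎
  where
  I : List ℕ
  I = range 2 (n ∸ 2)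
  columns-to-peaks : ∀ {π} → π ∈ L → deg1Internal π ≡ sum (map (λ i → peakAt i π) I)
  columns-to-peaks {π} π∈ = deg1Internal≡∑peaks (proj₁ (Equivalence.to (L⇔ π) π∈))
  peaks-at : ∀ {i} → i ∈ I → sum (map (peakAt i) L) ≡ catalan (n ∸ 1)
  peaks-at i∈ = let 2≤i , i<n = internal-column i∈ in peak-count-enumeration n L! L⇔ (<⇒≤ 2≤i) (<⇒≤ i<n)
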